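{- Let $G\in\mathcal{F}_{xy}^1$ and let $uvw$ be a triangle in $G$. If $u$ has degree at most $3$ in $G$, then $u$ is a terminal (i.e., $u\in\{x,y\}$).
   Context: All graphs are finite and simple. A graph with terminals is a graph with two distinguished vertices $x,y$. $G$ is $xy$-alternating on the torus if $G$ has genus $1$ and has an embedding in the torus with a face walk $v_1\dots v_l$ and indices $i_1<i_2<i_3<i_4$ with $v_{i_1}=v_{i_3}=x$, $v_{i_2}=v_{i_4}=y$. $\mathcal{A}_{xy}^1$ is the class of graphs with terminals $x,y$ that are planar or $xy$-alternating on the torus. Allowed minor operations on graphs with terminals: edge deletion and edge contraction, where contracting an edge joining the two terminals is forbidden and contracting an edge between a terminal and a non-terminal yields a terminal. $\mathcal{F}_{xy}^1$ is the set of graphs $G\notin\mathcal{A}_{xy}^1$ with $G\ast e\in\mathcal{A}_{xy}^1$ for every edge $e$ and every allowed minor operation $\ast$. -}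

module Defs where

open import Data.Nat using (ℕ; zero; suc; _+_; _*_; _<_; _≤_; _<ᵇ_; _≡ᵇ_)
open import Data.Fin using (Fin; toℕ) renaming (zero to fzero; suc to fsuc)
open import Data.Fin.Properties using (_≟_)
open import Data.Bool using (Bool; true; false; _∧_; _∨_; not; if_then_else_)
open import Data.Bool.Properties using (∨-comm)
open import Data.Product using (Σ; ∃; ∃-syntax; _×_; _,_)
open import Data.Sum using (_⊎_)
open import Data.Empty using (⊥)
open import Relation.Nullary using (¬_)
open import Relation.Nullary.Decidable using (⌊_⌋)
open import Relation.Binary.PropositionalEquality using (_≡_; _≢_; refl; trans)
open import Relation.Binary.Construct.Closure.ReflexiveTransitive using (Star)

record Graph : Set where
  field
    n       : ℕ
    adj     : Fin n → Fin n → Bool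
    adj-sym : ∀ u v → adj u v ≡ adj v u
    adj-irr : ∀ u → adj u u ≡ false

record TGraph : Set where
  field
    graph : Graph
    x     : Fin (Graph.n graph)
    y     : Fin (Graph.n graph)
    x≢y   : x ≢ y

iter : {A : Set} → (A → A) → ℕ → A → A
iter f zero    a = a
iter f (suc k) a = f (iter f k a)

count : ∀ {n} → (Fin n → Bool) → ℕ
count {zero}  p = 0
count {suc n} p = (if p fzero then 1 else 0) + count (λ i → p (fsuc i))

sumFin : ∀ {n} → (Fin n → ℕ) → ℕ
sumFin {zero}  f = 0
sumFin {suc n} f = f fzero + sumFin (λ i → f (fsuc i))

_⇔_ : Set → Set → Set
A ⇔ B = (A → B) × (B → A)

module _ (G : Graph) where
  open Graph G

  degree : Fin n → ℕ
  degree u = count (adj u)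

  edgeCount : ℕ
  edgeCount = sumFin (λ u → count (λ v → adj u v ∧ (toℕ u <ᵇ toℕ v)))

  isolatedCount : ℕ
  isolatedCount = count (λ u → degree u ≡ᵇ 0)

  Connected : Fin n → Fin n → Set
  Connected = Star (λ a b → adj a b ≡ true)

  HasComponents : ℕ → Set
  HasComponents c =
    Σ (Fin n → Fin c) λ f →
      (∀ i → ∃ λ v → f v ≡ i) × (∀ u v → (f u ≡ f v) ⇔ Connected u v)

  record Dart : Set where
    constructor dart
    field
      tail   : Fin n
      head   : Fin n
      isEdge : adj tail head ≡ true

  open Dart public

  rev : Dart → Dart
  rev (dart t h e) = dart h t (trans (adj-sym h t) e)

  -- rotation system: at every vertex a cyclic permutation of the darts leaving it
  record Rotation : Set where
    field
      ρ        : Dart → Dart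
      ρ-tail   : ∀ d → tail (ρ d) ≡ tail d
      ρ-inj    : ∀ d d' → ρ d ≡ ρ d' → d ≡ d'
      ρ-cyclic : ∀ d d' → tail d ≡ tail d' → ∃ λ k → iter ρ k d ≡ d'

    -- face permutation; its orbits are the face boundary walks
    φ : Dart → Dart
    φ d = ρ (rev d)

    SameFace : Dart → Dart → Set
    SameFace d d' = ∃ λ k → iter φ k d ≡ d'

    HasFaces : ℕ → Set
    HasFaces F =
      Σ (Dart → Fin F) λ f →
        (∀ i → ∃ λ d → f d ≡ i) × (∀ d d' → (f d ≡ f d') ⇔ SameFace d d')

    -- orientable genus g of the embedding given by the rotation system:
    -- Euler's formula summed over components (an isolated vertex is a
    -- component with one face):  n - E + (F + iso) = 2c - 2g
    HasGenus : ℕ → Set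
    HasGenus g = ∃ λ c → ∃ λ F →
      HasComponents c × HasFaces F ×
      (n + F + isolatedCount + 2 * g ≡ 2 * c + edgeCount)

  open Rotation public

  EmbedsIn : ℕ → Set
  EmbedsIn g = Σ Rotation λ R → HasGenus R g

  Planar : Set
  Planar = EmbedsIn 0

  Genus1 : Set
  Genus1 = ¬ Planar × EmbedsIn 1

  -- some face walk v_0 v_1 ... v_{l-1} (v_j = tail (φ^j d), l = orbit length)
  -- has indices i1 < i2 < i3 < i4 < l with v_{i1} = v_{i3} = s, v_{i2} = v_{i4} = t
  AlternatingFace : Rotation → Fin n → Fin n → Set
  AlternatingFace R s t =
    Σ Dart λ d → ∃ λ i1 → ∃ λ i2 → ∃ λ i3 → ∃ λ i4 →
      i1 < i2 × i2 < i3 × i3 < i4 ×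
      (∀ j → 0 < j → j ≤ i4 → iter (φ R) j d ≢ d) ×
      tail (iter (φ R) i1 d) ≡ s × tail (iter (φ R) i2 d) ≡ t ×
      tail (iter (φ R) i3 d) ≡ s × tail (iter (φ R) i4 d) ≡ t

  private
    isAB : Fin n → Fin n → Fin n → Fin n → Bool
    isAB a b u v = ⌊ u ≟ a ⌋ ∧ ⌊ v ≟ b ⌋

  deleteEdge : Fin n → Fin n → Graph
  deleteEdge a b = record
    { n = n
    ; adj = λ u v → adj u v ∧ not (isAB a b u v ∨ isAB a b v u)
    ; adj-sym = λ u v → symm u v
    ; adj-irr = λ u → irr u
    }
    where
    symm : ∀ u v → (adj u v ∧ not (isAB a b u v ∨ isAB a b v u))
                 ≡ (adj v u ∧ not (isAB a b v u ∨ isAB a b u v))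
    symm u v rewrite adj-sym u v | ∨-comm (isAB a b u v) (isAB a b v u) = refl
    irr : ∀ u → (adj u u ∧ not (isAB a b u u ∨ isAB a b u u)) ≡ false
    irr u rewrite adj-irr u = refl

module _ (T : TGraph) where
  open TGraph T
  open Graph graph

  InA : Set
  InA = Planar graph
      ⊎ (Genus1 graph × Σ (Rotation graph) λ R → HasGenus R 1 × AlternatingFace graph R x y)

module _ (T : TGraph) where
  open TGraph T
  open Graph graph

  deleteT : Fin n → Fin n → TGraph
  deleteT a b = record { graph = deleteEdge graph a b ; x = x ; y = y ; x≢y = x≢y }

  -- H is (isomorphic to) the graph with terminals obtained from T by contracting ab;
  -- f is the quotient map identifying exactly a and b
  record IsContraction (a b : Fin n) (H : TGraph) : Set where
    private
      module H = Graph (TGraph.graph H)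
    field
      f      : Fin n → Fin H.n
      f-surj : ∀ w → ∃ λ v → f v ≡ w
      f-ab   : f a ≡ f b
      f-inj  : ∀ u v → f u ≡ f v → u ≡ v ⊎ (u ≡ a × v ≡ b) ⊎ (u ≡ b × v ≡ a)
      f-adj  : ∀ p q → (H.adj p q ≡ true) ⇔
                 (p ≢ q × ∃ λ u → ∃ λ v → f u ≡ p × f v ≡ q × adj u v ≡ true)
      f-x    : f x ≡ TGraph.x H
      f-y    : f y ≡ TGraph.y H

  record InF : Set₁ where
    field
      notA  : ¬ InA T
      del   : ∀ a b → adj a b ≡ true → InA (deleteT a b)
      contr : ∀ a b → adj a b ≡ true → ¬ ((a ≡ x × b ≡ y) ⊎ (a ≡ y × b ≡ x)) →
              ∀ H → IsContraction a b H → InA H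

module Submission where

-- Suppose u ∉ {x, y}. By minimality G − vw is in A¹ₓᵧ, so it has a planar embedding, or a
-- toroidal one with an xy-alternating face. Since u has degree at most 3, the darts from u to
-- v and to w are consecutive in the rotation at u, so some face passes through the corner
-- v u w. Drawing vw inside that face splits it into the triangle uvw and a face whose boundary
-- is the old one with u cut out. Edges and faces both grow by one, so the genus is unchanged,
-- and since u is neither x nor y every alternation of x and y survives. Hence G ∈ A¹ₓᵧ, a
-- contradiction.

open import Defs
open import Data.Nat using (ℕ; zero; suc; _+_; _*_; _<_; _≤_; z≤n; s≤s; _<ᵇ_; _≡ᵇ_)
open import Data.Nat.Properties
  using (+-suc; +-comm; +-identityʳ; +-cancelˡ-<; ≤-refl; ≤-trans; <-trans; ≤-<-trans; <-≤-trans;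
         <-cmp; <-irrefl; <-asym; <⇒≤; ≤-pred; n<1+n; n≤1+n; m≤n⇒m≤1+n; m≤n+m; m≤n⇒m<n∨m≡n;
         m≤n⇒∃[o]m+o≡n; <⇒<ᵇ; <ᵇ⇒<)
open import Data.Fin using (Fin; toℕ; fromℕ; inject₁) renaming (zero to fzero; suc to fsuc)
open import Data.Fin.Properties using (_≟_; toℕ-injective; fromℕ≢inject₁; inject₁-injective)
import Data.Fin.Properties as Fin
import Data.Fin.Relation.Unary.Top as Top
open Top using (‵fromℕ; ‵inject₁)
open import Data.Bool using (Bool; true; false; T; _∧_; not; if_then_else_)
open import Axiom.UniquenessOfIdentityProofs using (module Decidable⇒UIP)
import Data.Bool.Properties as Bool
open import Data.Bool.Properties using (T-≡; ∧-identityʳ; ∧-zeroʳ; ∧-conicalˡ)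
open import Function using (_∘_; id; Equivalence)
open import Data.Product using (Σ; ∃; _×_; _,_; proj₁; proj₂)
open import Data.Sum using (_⊎_; inj₁; inj₂; [_,_]′)
open import Data.Empty using (⊥; ⊥-elim)
open import Relation.Nullary using (¬_; Dec; yes; no; does; contradiction)
open import Relation.Nullary.Decidable using (⌊_⌋; isYes≗does; ⌊⌋-map′; dec-true; dec-false; _×-dec_; _⊎-dec_)
open import Relation.Binary using (DecidableEquality; tri<; tri≈; tri>)
open import Relation.Binary.PropositionalEquality
open import Relation.Binary.Construct.Closure.ReflexiveTransitive using (ε; _◅_; gmap)

-- Iterates and orbits

module _ {A : Set} (f : A → A) where

  iter-+ : ∀ j k a → iter f (j + k) a ≡ iter f j (iter f k a)
  iter-+ zero    k a = refl
  iter-+ (suc j) k a = cong f (iter-+ j k a)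

  iter-sucʳ : ∀ k a → iter f (suc k) a ≡ iter f k (f a)
  iter-sucʳ zero    a = refl
  iter-sucʳ (suc k) a = cong f (iter-sucʳ k a)

  iter-injective : (∀ a b → f a ≡ f b → a ≡ b) → ∀ k a b → iter f k a ≡ iter f k b → a ≡ b
  iter-injective inj zero    a b e = e
  iter-injective inj (suc k) a b e = iter-injective inj k a b (inj _ _ e)

iter-natural : {A B : Set} (f : A → A) (g : B → B) (h : B → A) →
  (∀ b → f (h b) ≡ h (g b)) → ∀ k b → iter f k (h b) ≡ h (iter g k b)
iter-natural f g h comm zero    b = refl
iter-natural f g h comm (suc k) b = trans (cong f (iter-natural f g h comm k b)) (comm _)

iter-distinct : {A : Set} (f : A → A) → (∀ a b → f a ≡ f b → a ≡ b) → ∀ {a N} →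
  (∀ j → 0 < j → j ≤ N → iter f j a ≢ a) → ∀ i j → i < j → j ≤ N → iter f i a ≢ iter f j a
iter-distinct f inj {a} no-return i j i<j j≤N e with m≤n⇒∃[o]m+o≡n i<j
... | o , refl = no-return (suc o) (s≤s z≤n) (≤-trans (s≤s (m≤n+m o i)) j≤N)
                   (sym (iter-injective f inj i _ _ (trans e shift)))
  where
  shift : iter f (suc i + o) a ≡ iter f i (iter f (suc o) a)
  shift = trans (cong (λ m → iter f m a) (sym (+-suc i o))) (iter-+ f i (suc o) a)

Orbit : {A : Set} → (A → A) → A → A → Set
Orbit f a b = ∃ λ k → iter f k a ≡ b

orbit-trans : {A : Set} (f : A → A) {a b c : A} → Orbit f a b → Orbit f b c → Orbit f a c
orbit-trans f {a} (j , refl) (k , refl) = k + j , iter-+ f k j a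

orbit-conj : {A B : Set} (f : A → A) (g : B → B) (h : B → A) →
  (∀ b → f (h b) ≡ h (g b)) → ∀ {a b} → Orbit g a b → Orbit f (h a) (h b)
orbit-conj f g h comm (k , refl) = k , iter-natural f g h comm k _

orbit-of-fixed : {A : Set} (f : A → A) {a b : A} → f a ≡ a → Orbit f a b → b ≡ a
orbit-of-fixed f fa (k , refl) = fixed k
  where
  fixed : ∀ k → iter f k _ ≡ _
  fixed zero    = refl
  fixed (suc k) = trans (cong f (fixed k)) fa

orbit-of-2-cycle : {A : Set} (f : A → A) {a b : A} → f (f a) ≡ a → Orbit f a b → b ≡ a ⊎ b ≡ f a
orbit-of-2-cycle f {a} ffa (k , refl) = cycle k
  where
  cycle : ∀ k → iter f k a ≡ a ⊎ iter f k a ≡ f a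
  cycle zero = inj₁ refl
  cycle (suc k) with cycle k
  ... | inj₁ e = inj₂ (cong f e)
  ... | inj₂ e = inj₁ (trans (cong f e) ffa)

first-hit : (P : ℕ → Set) → (∀ k → Dec (P k)) → ∀ N →
  ∃ λ r → r ≤ suc N × (r ≤ N → P r) × (∀ k → k < r → ¬ P k)
first-hit P P? zero with P? 0
... | yes p0 = 0 , z≤n , (λ _ → p0) , (λ _ ())
... | no ¬p0 = 1 , ≤-refl , (λ ()) , λ { zero _ → ¬p0 ; (suc _) (s≤s ()) }
first-hit P P? (suc N) with first-hit P P? N
... | r , r≤ , hit , miss with m≤n⇒m<n∨m≡n r≤
...   | inj₁ r<1+N = r , m≤n⇒m≤1+n r≤ , (λ _ → hit (≤-pred r<1+N)) , miss
...   | inj₂ refl with P? (suc N)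
...     | yes p  = suc N , n≤1+n (suc N) , (λ _ → p) , miss
...     | no ¬p  = suc (suc N) , ≤-refl , (λ le → ⊥-elim (<-irrefl refl le)) , miss⁺
  where
  miss⁺ : ∀ k → k < suc (suc N) → ¬ P k
  miss⁺ k k<2+N with m≤n⇒m<n∨m≡n (≤-pred k<2+N)
  ... | inj₁ k<1+N = miss k k<1+N
  ... | inj₂ refl  = ¬p

-- Counting

<ᵇ≡true : ∀ {m n} → m < n → (m <ᵇ n) ≡ true
<ᵇ≡true m<n = Equivalence.to T-≡ (<⇒<ᵇ m<n)

<ᵇ≡false : ∀ {m n} → n < m → (m <ᵇ n) ≡ false
<ᵇ≡false {m} {n} n<m with m <ᵇ n in e
... | false = refl
... | true  = ⊥-elim (<-asym n<m (<ᵇ⇒< m n (subst T (sym e) _)))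

count-cong : ∀ {n} (p q : Fin n → Bool) → (∀ i → p i ≡ q i) → count p ≡ count q
count-cong {zero}  p q e = refl
count-cong {suc n} p q e =
  cong₂ _+_ (cong (λ b → if b then 1 else 0) (e fzero)) (count-cong _ _ (λ i → e (fsuc i)))

count≡0⇒false : ∀ {n} (p : Fin n → Bool) → count p ≡ 0 → ∀ i → p i ≡ false
count≡0⇒false {suc n} p e i with p fzero in p0
count≡0⇒false {suc n} p ()  i        | true
count≡0⇒false {suc n} p e   fzero    | false = p0
count≡0⇒false {suc n} p e   (fsuc i) | false = count≡0⇒false (λ j → p (fsuc j)) e i

false⇒count≡0 : ∀ {n} (p : Fin n → Bool) → (∀ i → p i ≡ false) → count p ≡ 0
false⇒count≡0 {zero}  p e = refl
false⇒count≡0 {suc n} p e rewrite e fzero = false⇒count≡0 (λ j → p (fsuc j)) (λ j → e (fsuc j))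

count-mono : ∀ {n} (p q : Fin n → Bool) → (∀ i → p i ≡ true → q i ≡ true) → count p ≤ count q
count-mono {zero}  p q h = z≤n
count-mono {suc n} p q h with p fzero in p0 | q fzero in q0
... | true  | true  = s≤s (count-mono _ _ (λ i → h (fsuc i)))
... | true  | false = contradiction (trans (sym (h fzero p0)) q0) λ ()
... | false | true  = m≤n⇒m≤1+n (count-mono _ _ (λ i → h (fsuc i)))
... | false | false = count-mono _ _ (λ i → h (fsuc i))

infixl 20 _∖_

_∖_ : ∀ {n} → (Fin n → Bool) → Fin n → Fin n → Bool
(p ∖ a) i = p i ∧ not ⌊ i ≟ a ⌋

∖-true : ∀ {n} (p : Fin n → Bool) {a i} → p i ≡ true → i ≢ a → (p ∖ a) i ≡ true
∖-true p {a} {i} pi i≢a rewrite pi | isYes≗does (i ≟ a) | dec-false (i ≟ a) i≢a = refl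

∖-fsuc : ∀ {n} (p : Fin (suc n) → Bool) a i → ((λ j → p (fsuc j)) ∖ a) i ≡ (p ∖ fsuc a) (fsuc i)
∖-fsuc p a i = cong (λ b → p (fsuc i) ∧ not b) (sym (⌊⌋-map′ _ _ (i ≟ a)))

count-remove : ∀ {n} (p : Fin n → Bool) (a : Fin n) → p a ≡ true → count p ≡ suc (count (p ∖ a))
count-remove {suc n} p fzero pa rewrite pa =
  cong suc (count-cong _ _ λ i → sym (∧-identityʳ (p (fsuc i))))
count-remove {suc n} p (fsuc a) pa with p fzero
... | true  = cong suc (trans (count-remove _ a pa) (cong suc (count-cong _ _ (∖-fsuc p a))))
... | false = trans (count-remove _ a pa) (cong suc (count-cong _ _ (∖-fsuc p a)))

count≤3⇒¬four : ∀ {n} (p : Fin n → Bool) (a b c d : Fin n) →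
  p a ≡ true → p b ≡ true → p c ≡ true → p d ≡ true →
  a ≢ b → a ≢ c → a ≢ d → b ≢ c → b ≢ d → c ≢ d → ¬ count p ≤ 3
count≤3⇒¬four p a b c d pa pb pc pd a≢b a≢c a≢d b≢c b≢d c≢d le = 4+k≰3 (subst (_≤ 3) count-≡4+ le)
  where
  4+k≰3 : ∀ {k} → ¬ suc (suc (suc (suc k))) ≤ 3
  4+k≰3 (s≤s (s≤s (s≤s ())))
  count-≡4+ : count p ≡ suc (suc (suc (suc (count (p ∖ a ∖ b ∖ c ∖ d)))))
  count-≡4+ = trans (count-remove p a pa)
         (cong suc (trans (count-remove (p ∖ a) b (∖-true p pb (≢-sym a≢b)))
         (cong suc (trans (count-remove (p ∖ a ∖ b) c (∖-true (p ∖ a) (∖-true p pc (≢-sym a≢c)) (≢-sym b≢c)))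
         (cong suc (count-remove (p ∖ a ∖ b ∖ c) d
           (∖-true (p ∖ a ∖ b) (∖-true (p ∖ a) (∖-true p pd (≢-sym a≢d)) (≢-sym b≢d)) (≢-sym c≢d))))))))

count-differ-at : ∀ {n} (p q : Fin n → Bool) (a : Fin n) → p a ≡ true → q a ≡ false →
  (∀ i → i ≢ a → p i ≡ q i) → count p ≡ suc (count q)
count-differ-at p q a pa qa agree = trans (count-remove p a pa) (cong suc (count-cong _ _ same))
  where
  same : ∀ i → (p ∖ a) i ≡ q i
  same i with i ≟ a
  ... | yes refl = trans (∧-zeroʳ (p a)) (sym qa)
  ... | no i≢a   = trans (∧-identityʳ (p i)) (agree i i≢a)

sumFin-cong : ∀ {n} (f g : Fin n → ℕ) → (∀ i → f i ≡ g i) → sumFin f ≡ sumFin g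
sumFin-cong {zero}  f g e = refl
sumFin-cong {suc n} f g e = cong₂ _+_ (e fzero) (sumFin-cong _ _ λ i → e (fsuc i))

sumFin-differ-at : ∀ {n} (f g : Fin n → ℕ) (a : Fin n) → f a ≡ suc (g a) →
  (∀ i → i ≢ a → f i ≡ g i) → sumFin f ≡ suc (sumFin g)
sumFin-differ-at {suc n} f g fzero fa agree =
  cong₂ _+_ fa (sumFin-cong _ _ λ i → agree (fsuc i) λ ())
sumFin-differ-at {suc n} f g (fsuc a) fa agree
  rewrite agree fzero (λ ())
        | sumFin-differ-at (λ i → f (fsuc i)) (λ i → g (fsuc i)) a fa
            (λ i i≢a → agree (fsuc i) (i≢a ∘ Fin.suc-injective))
  = +-suc (g fzero) _

-- Darts and rotation systems

module _ (G : Graph) where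
  open Graph G

  adj⇒≢ : ∀ {s t} → adj s t ≡ true → s ≢ t
  adj⇒≢ {s} e refl = contradiction (trans (sym e) (adj-irr s)) λ ()

  adj-flip : ∀ {s t} → adj s t ≡ true → adj t s ≡ true
  adj-flip {s} {t} e = trans (adj-sym t s) e

module _ {G : Graph} where
  open Graph G

  dart-≡ : {d d' : Dart G} → tail d ≡ tail d' → head d ≡ head d' → d ≡ d'
  dart-≡ {dart t h e} {dart .t .h e'} refl refl = cong (dart t h) (Decidable⇒UIP.≡-irrelevant Bool._≟_ e e')

  _≟ᵈ_ : DecidableEquality (Dart G)
  d ≟ᵈ d' with tail d ≟ tail d' | head d ≟ head d'
  ... | yes t≡ | yes h≡ = yes (dart-≡ t≡ h≡)
  ... | no t≢  | _      = no (t≢ ∘ cong tail)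
  ... | _      | no h≢  = no (h≢ ∘ cong head)

  rev-involutive : ∀ d → rev G (rev G d) ≡ d
  rev-involutive d = dart-≡ refl refl

  rev-injective : ∀ d d' → rev G d ≡ rev G d' → d ≡ d'
  rev-injective d d' e = trans (sym (rev-involutive d)) (trans (cong (rev G) e) (rev-involutive d'))

  module _ (R : Rotation G) where

    φ-injective : ∀ d d' → φ R d ≡ φ R d' → d ≡ d'
    φ-injective d d' e = rev-injective d d' (ρ-inj R _ _ e)

    tail-φ : ∀ d → tail (φ R d) ≡ head d
    tail-φ d = ρ-tail R (rev G d)

    ρ-predecessor : ∀ d → ∃ λ c → ρ R c ≡ d
    ρ-predecessor d with ρ-cyclic R (ρ R d) d (ρ-tail R d)
    ... | zero  , e = d , e
    ... | suc k , e = iter (ρ R) k (ρ R d) , e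

    module _ {u : Fin n} (deg : degree G u ≤ 3) where

      ¬four-darts : (a b c d : Dart G) → tail a ≡ u → tail b ≡ u → tail c ≡ u → tail d ≡ u →
        a ≢ b → a ≢ c → a ≢ d → b ≢ c → b ≢ d → c ≢ d → ⊥
      ¬four-darts a b c d refl tb tc td a≢b a≢c a≢d b≢c b≢d c≢d =
        count≤3⇒¬four (adj u) (head a) (head b) (head c) (head d)
          (isEdge a) (at-u b tb) (at-u c tc) (at-u d td)
          (heads≢ b tb a≢b) (heads≢ c tc a≢c) (heads≢ d td a≢d)
          (λ e → b≢c (dart-≡ (trans tb (sym tc)) e)) (λ e → b≢d (dart-≡ (trans tb (sym td)) e))
          (λ e → c≢d (dart-≡ (trans tc (sym td)) e)) deg
        where
        at-u : ∀ x → tail x ≡ u → adj u (head x) ≡ true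
        at-u x refl = isEdge x
        heads≢ : ∀ x → tail x ≡ u → a ≢ x → head a ≢ head x
        heads≢ x tx a≢x e = a≢x (dart-≡ (sym tx) e)

      -- The rotation at u is a cycle of length at most 3.
      consecutive-at-degree≤3 : ∀ a b → tail a ≡ u → tail b ≡ u → a ≢ b → ρ R a ≡ b ⊎ ρ R b ≡ a
      consecutive-at-degree≤3 a b ta tb a≢b with ρ-cyclic R a b (trans ta (sym tb)) | ρ R a ≟ᵈ b
      ... | _     | yes e = inj₁ e
      ... | reach | no ρa≢b with ρ R a ≟ᵈ a
      ...   | yes fixed = ⊥-elim (a≢b (sym (orbit-of-fixed (ρ R) fixed reach)))
      ...   | no ρa≢a with ρ R (ρ R a) ≟ᵈ b | ρ R (ρ R a) ≟ᵈ a
      ...     | no ρρa≢b | yes cycle =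
                  ⊥-elim ([ a≢b ∘ sym , ρa≢b ∘ sym ]′ (orbit-of-2-cycle (ρ R) cycle reach))
      ...     | no ρρa≢b | no ρρa≢a =
                  ⊥-elim (¬four-darts a b (ρ R a) (ρ R (ρ R a)) ta tb
                    (trans (ρ-tail R a) ta) (trans (ρ-tail R _) (trans (ρ-tail R a) ta))
                    a≢b (≢-sym ρa≢a) (≢-sym ρρa≢a) (≢-sym ρa≢b) (≢-sym ρρa≢b)
                    (λ e → ρa≢a (sym (ρ-inj R _ _ e))))
      ...     | yes ρρa≡b | _ with ρ R b ≟ᵈ a
      ...       | yes e   = inj₂ e
      ...       | no ρb≢a =
                  ⊥-elim (¬four-darts a b (ρ R a) (ρ R b) ta tb (trans (ρ-tail R a) ta) (trans (ρ-tail R b) tb)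
                    a≢b (≢-sym ρa≢a) (≢-sym ρb≢a) (≢-sym ρa≢b)
                    (λ e → ρa≢b (ρ-inj R _ _ (trans ρρa≡b e)))
                    (λ e → a≢b (ρ-inj R _ _ e)))

-- Deleting an edge

Joins : {A : Set} → A → A → A → A → Set
Joins a b s t = (s ≡ a × t ≡ b) ⊎ (t ≡ a × s ≡ b)

module _ {A : Set} {a b : A} where

  Joins-transfer : ∀ {c d s t} → Joins a b c d → Joins a b s t → Joins c d s t
  Joins-transfer (inj₁ (refl , refl)) (inj₁ (refl , refl)) = inj₁ (refl , refl)
  Joins-transfer (inj₁ (refl , refl)) (inj₂ (refl , refl)) = inj₂ (refl , refl)
  Joins-transfer (inj₂ (refl , refl)) (inj₁ (refl , refl)) = inj₂ (refl , refl)
  Joins-transfer (inj₂ (refl , refl)) (inj₂ (refl , refl)) = inj₁ (refl , refl)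

  Joins-functional : a ≢ b → ∀ {s t t'} → Joins a b s t → Joins a b s t' → t ≡ t'
  Joins-functional a≢b (inj₁ (refl , refl)) (inj₁ (_ , refl))    = refl
  Joins-functional a≢b (inj₁ (refl , refl)) (inj₂ (_ , e))       = ⊥-elim (a≢b e)
  Joins-functional a≢b (inj₂ (refl , refl)) (inj₁ (e , _))       = ⊥-elim (a≢b (sym e))
  Joins-functional a≢b (inj₂ (refl , refl)) (inj₂ (refl , _))    = refl

  Joins-opposite : ∀ {s t m M} → Joins a b s t → Joins a b m M → s ≢ m → s ≡ M × t ≡ m
  Joins-opposite (inj₁ (refl , refl)) (inj₁ (refl , refl)) s≢m = ⊥-elim (s≢m refl)
  Joins-opposite (inj₁ (refl , refl)) (inj₂ (refl , refl)) s≢m = refl , refl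
  Joins-opposite (inj₂ (refl , refl)) (inj₁ (refl , refl)) s≢m = refl , refl
  Joins-opposite (inj₂ (refl , refl)) (inj₂ (refl , refl)) s≢m = ⊥-elim (s≢m refl)

joins? : {A : Set} → DecidableEquality A → ∀ a b s t → Dec (Joins a b s t)
joins? _≟ₐ_ a b s t = (s ≟ₐ a ×-dec t ≟ₐ b) ⊎-dec (t ≟ₐ a ×-dec s ≟ₐ b)

module EdgeDeletion (G : Graph) (v w : Fin (Graph.n G)) where
  open Graph G

  G' : Graph
  G' = deleteEdge G v w

  adj' : Fin n → Fin n → Bool
  adj' = Graph.adj G'

  adj'-≡ : ∀ s t → adj' s t ≡ adj s t ∧ not (does (joins? _≟_ v w s t))
  adj'-≡ s t rewrite isYes≗does (s ≟ v) | isYes≗does (t ≟ w) | isYes≗does (t ≟ v) | isYes≗does (s ≟ w) = refl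

  adj'-joins : ∀ {s t} → Joins v w s t → adj' s t ≡ false
  adj'-joins {s} {t} j rewrite adj'-≡ s t | dec-true (joins? _≟_ v w s t) j = ∧-zeroʳ (adj s t)

  adj'-¬joins : ∀ {s t} → ¬ Joins v w s t → adj' s t ≡ adj s t
  adj'-¬joins {s} {t} ¬j rewrite adj'-≡ s t | dec-false (joins? _≟_ v w s t) ¬j = ∧-identityʳ (adj s t)

  adj'⇒adj : ∀ {s t} → adj' s t ≡ true → adj s t ≡ true
  adj'⇒adj {s} {t} e = ∧-conicalˡ (adj s t) _ e

  adj⇒adj' : ∀ {s t} → adj s t ≡ true → ¬ Joins v w s t → adj' s t ≡ true
  adj⇒adj' e ¬j = trans (adj'-¬joins ¬j) e

  degree-G'≤ : ∀ s → degree G' s ≤ degree G s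
  degree-G'≤ s = count-mono (adj' s) (adj s) (λ t → adj'⇒adj)

-- Adding an edge across a face corner

module CornerInsertion
  (G : Graph) (v w : Fin (Graph.n G)) (u p q : Fin (Graph.n G)) (pq-deleted : Joins v w p q)
  (u-p : Graph.adj G u p ≡ true) (u-q : Graph.adj G u q ≡ true) (p-q : Graph.adj G p q ≡ true)
  (R' : Rotation (EdgeDeletion.G' G v w)) where
  open Graph G
  open EdgeDeletion G v w

  u≢p : u ≢ p
  u≢p = adj⇒≢ G u-p
  u≢q : u ≢ q
  u≢q = adj⇒≢ G u-q
  p≢q : p ≢ q
  p≢q = adj⇒≢ G p-q

  joins-pq⇒vw : ∀ {s t} → Joins p q s t → Joins v w s t
  joins-pq⇒vw = Joins-transfer (Joins-transfer pq-deleted (inj₁ (refl , refl)))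

  adj'-pq : ∀ {s t} → Joins p q s t → adj' s t ≡ false
  adj'-pq = adj'-joins ∘ joins-pq⇒vw

  kept : ∀ {s t} → adj s t ≡ true → ¬ Joins p q s t → adj' s t ≡ true
  kept e ¬j = adj⇒adj' e (¬j ∘ Joins-transfer pq-deleted)

  ¬joins-from-u : ∀ {t} → ¬ Joins p q u t
  ¬joins-from-u (inj₁ (e , _)) = u≢p e
  ¬joins-from-u (inj₂ (_ , e)) = u≢q e

  ¬joins-to-u : ∀ {s} → ¬ Joins p q s u
  ¬joins-to-u (inj₁ (_ , e)) = u≢q e
  ¬joins-to-u (inj₂ (e , _)) = u≢p e

  D' : Set
  D' = Dart G'
  ρ' φ' rev' : D' → D'
  ρ'   = ρ R'
  φ'   = φ R'
  rev' = rev G'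

  up uq pu qu : D'
  up = dart u p (kept u-p ¬joins-from-u)
  uq = dart u q (kept u-q ¬joins-from-u)
  pu = dart p u (kept (adj-flip G u-p) ¬joins-to-u)
  qu = dart q u (kept (adj-flip G u-q) ¬joins-to-u)

  data Dart⁺ : Set where
    old   : D' → Dart⁺
    pq qp : Dart⁺

  old-injective : ∀ {a b} → old a ≡ old b → a ≡ b
  old-injective refl = refl

  embed : Dart⁺ → Dart G
  embed (old (dart s t e)) = dart s t (adj'⇒adj e)
  embed pq = dart p q p-q
  embed qp = dart q p (adj-flip G p-q)

  classify : Dart G → Dart⁺
  classify (dart s t e) with joins? _≟_ p q s t
  ... | no ¬j       = old (dart s t (kept e ¬j))
  ... | yes (inj₁ _) = pq
  ... | yes (inj₂ _) = qp

  embed-classify : ∀ d → embed (classify d) ≡ d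
  embed-classify (dart s t e) with joins? _≟_ p q s t
  ... | no _                     = dart-≡ refl refl
  ... | yes (inj₁ (refl , refl)) = dart-≡ refl refl
  ... | yes (inj₂ (refl , refl)) = dart-≡ refl refl

  classify-embed : ∀ x → classify (embed x) ≡ x
  classify-embed (old (dart s t e)) with joins? _≟_ p q s t
  ... | no _  = cong old (dart-≡ refl refl)
  ... | yes j = contradiction (trans (sym e) (adj'-pq j)) λ ()
  classify-embed pq with joins? _≟_ p q p q
  ... | no ¬j               = ⊥-elim (¬j (inj₁ (refl , refl)))
  ... | yes (inj₁ _)        = refl
  ... | yes (inj₂ (_ , e))  = ⊥-elim (p≢q e)
  classify-embed qp with joins? _≟_ p q q p
  ... | no ¬j               = ⊥-elim (¬j (inj₂ (refl , refl)))
  ... | yes (inj₁ (e , _))  = ⊥-elim (p≢q (sym e))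
  ... | yes (inj₂ _)        = refl

  embed-injective : ∀ x y → embed x ≡ embed y → x ≡ y
  embed-injective x y e = trans (sym (classify-embed x)) (trans (cong classify e) (classify-embed y))

  tail⁺ : Dart⁺ → Fin n
  tail⁺ x = tail (embed x)

  -- In G the dart pq is placed just before pu in the rotation at p, and qp just after qu at q.
  ρ⁺ : Dart⁺ → Dart⁺
  ρ⁺ (old d) with ρ' d ≟ᵈ pu | d ≟ᵈ qu
  ... | yes _ | _     = pq
  ... | no _  | yes _ = qp
  ... | no _  | no _  = old (ρ' d)
  ρ⁺ pq = old pu
  ρ⁺ qp = old (ρ' qu)

  data ρ⁺-OldView (d : D') : Dart⁺ → Set where
    to-pq  : ρ' d ≡ pu → ρ⁺-OldView d pq
    to-qp  : ρ' d ≢ pu → d ≡ qu → ρ⁺-OldView d qp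
    to-old : ρ' d ≢ pu → d ≢ qu → ρ⁺-OldView d (old (ρ' d))

  ρ⁺-view : ∀ d → ρ⁺-OldView d (ρ⁺ (old d))
  ρ⁺-view d with ρ' d ≟ᵈ pu | d ≟ᵈ qu
  ... | yes e   | _      = to-pq e
  ... | no ≢pu  | yes e  = to-qp ≢pu e
  ... | no ≢pu  | no ≢qu = to-old ≢pu ≢qu

  ρ'-tail : ∀ d → tail (ρ' d) ≡ tail d
  ρ'-tail = ρ-tail R'

  ρ'-injective : ∀ a b → ρ' a ≡ ρ' b → a ≡ b
  ρ'-injective = ρ-inj R'

  ρ'qu≢pu : ρ' qu ≢ pu
  ρ'qu≢pu e = p≢q (trans (sym (cong tail e)) (ρ'-tail qu))

  ρ⁺-tail : ∀ x → tail⁺ (ρ⁺ x) ≡ tail⁺ x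
  ρ⁺-tail (old d) with ρ⁺ (old d) | ρ⁺-view d
  ... | _ | to-pq e      = trans (sym (cong tail e)) (ρ'-tail d)
  ... | _ | to-qp _ e    = sym (cong tail e)
  ... | _ | to-old _ _   = ρ'-tail d
  ρ⁺-tail pq = refl
  ρ⁺-tail qp = ρ'-tail qu

  ρ⁺-injective : ∀ x y → ρ⁺ x ≡ ρ⁺ y → x ≡ y
  ρ⁺-injective (old a) (old b) e with ρ⁺ (old a) | ρ⁺-view a | ρ⁺ (old b) | ρ⁺-view b
  ... | _ | to-pq ea      | _ | to-pq eb      = cong old (ρ'-injective a b (trans ea (sym eb)))
  ... | _ | to-qp _ ea    | _ | to-qp _ eb    = cong old (trans ea (sym eb))
  ... | _ | to-old _ _    | _ | to-old _ _    = cong old (ρ'-injective a b (old-injective e))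
  ρ⁺-injective (old a) (old b) () | _ | to-pq _ | _ | to-qp _ _
  ρ⁺-injective (old a) (old b) () | _ | to-pq _ | _ | to-old _ _
  ρ⁺-injective (old a) (old b) () | _ | to-qp _ _ | _ | to-pq _
  ρ⁺-injective (old a) (old b) () | _ | to-qp _ _ | _ | to-old _ _
  ρ⁺-injective (old a) (old b) () | _ | to-old _ _ | _ | to-pq _
  ρ⁺-injective (old a) (old b) () | _ | to-old _ _ | _ | to-qp _ _
  ρ⁺-injective (old a) pq e with ρ⁺ (old a) | ρ⁺-view a
  ... | _ | to-old ≢pu _ = ⊥-elim (≢pu (old-injective e))
  ρ⁺-injective (old a) pq () | _ | to-pq _
  ρ⁺-injective (old a) pq () | _ | to-qp _ _
  ρ⁺-injective (old a) qp e with ρ⁺ (old a) | ρ⁺-view a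
  ... | _ | to-old _ ≢qu = ⊥-elim (≢qu (ρ'-injective a qu (old-injective e)))
  ρ⁺-injective (old a) qp () | _ | to-pq _
  ρ⁺-injective (old a) qp () | _ | to-qp _ _
  ρ⁺-injective pq (old b) e = sym (ρ⁺-injective (old b) pq (sym e))
  ρ⁺-injective qp (old b) e = sym (ρ⁺-injective (old b) qp (sym e))
  ρ⁺-injective pq pq e = refl
  ρ⁺-injective qp qp e = refl
  ρ⁺-injective pq qp e = ⊥-elim (ρ'qu≢pu (sym (old-injective e)))
  ρ⁺-injective qp pq e = ⊥-elim (ρ'qu≢pu (old-injective e))

  pu⁻ : D'
  pu⁻ = proj₁ (ρ-predecessor R' pu)

  ρ'pu⁻ : ρ' pu⁻ ≡ pu
  ρ'pu⁻ = proj₂ (ρ-predecessor R' pu)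

  tail-pu⁻ : tail pu⁻ ≡ p
  tail-pu⁻ = trans (sym (ρ'-tail pu⁻)) (cong tail ρ'pu⁻)

  ρ⁺-pu⁻ : ρ⁺ (old pu⁻) ≡ pq
  ρ⁺-pu⁻ with ρ⁺ (old pu⁻) | ρ⁺-view pu⁻
  ... | _ | to-pq _       = refl
  ... | _ | to-qp ≢pu _   = ⊥-elim (≢pu ρ'pu⁻)
  ... | _ | to-old ≢pu _  = ⊥-elim (≢pu ρ'pu⁻)

  ρ⁺-qu : ρ⁺ (old qu) ≡ qp
  ρ⁺-qu with ρ⁺ (old qu) | ρ⁺-view qu
  ... | _ | to-pq e       = ⊥-elim (ρ'qu≢pu e)
  ... | _ | to-qp _ _     = refl
  ... | _ | to-old _ ≢qu  = ⊥-elim (≢qu refl)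

  ρ⁺-orbit-ρ' : ∀ d → Orbit ρ⁺ (old d) (old (ρ' d))
  ρ⁺-orbit-ρ' d with ρ⁺ (old d) in eq | ρ⁺-view d
  ... | _ | to-pq e    = 2 , trans (cong ρ⁺ eq) (cong old (sym e))
  ... | _ | to-qp _ e  = 2 , trans (cong ρ⁺ eq) (cong (old ∘ ρ') (sym e))
  ... | _ | to-old _ _ = 1 , eq

  ρ⁺-orbit-iter : ∀ k d → Orbit ρ⁺ (old d) (old (iter ρ' k d))
  ρ⁺-orbit-iter zero    d = 0 , refl
  ρ⁺-orbit-iter (suc k) d = orbit-trans ρ⁺ (ρ⁺-orbit-iter k d) (ρ⁺-orbit-ρ' (iter ρ' k d))

  ρ⁺-cyclic-old : ∀ d y → tail d ≡ tail⁺ y → Orbit ρ⁺ (old d) y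
  ρ⁺-cyclic-old d (old b) e with ρ-cyclic R' d b e
  ... | k , refl = ρ⁺-orbit-iter k d
  ρ⁺-cyclic-old d pq e =
    orbit-trans ρ⁺ (ρ⁺-cyclic-old d (old pu⁻) (trans e (sym tail-pu⁻))) (1 , ρ⁺-pu⁻)
  ρ⁺-cyclic-old d qp e = orbit-trans ρ⁺ (ρ⁺-cyclic-old d (old qu) e) (1 , ρ⁺-qu)

  ρ⁺-cyclic : ∀ x y → tail⁺ x ≡ tail⁺ y → Orbit ρ⁺ x y
  ρ⁺-cyclic (old d) y e = ρ⁺-cyclic-old d y e
  ρ⁺-cyclic pq y e = orbit-trans ρ⁺ (1 , refl) (ρ⁺-cyclic-old pu y e)
  ρ⁺-cyclic qp y e = orbit-trans ρ⁺ (1 , refl) (ρ⁺-cyclic-old (ρ' qu) y (trans (ρ'-tail qu) e))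

  ρᴳ : Dart G → Dart G
  ρᴳ d = embed (ρ⁺ (classify d))

  ρᴳ-embed : ∀ x → ρᴳ (embed x) ≡ embed (ρ⁺ x)
  ρᴳ-embed x = cong (embed ∘ ρ⁺) (classify-embed x)

  R : Rotation G
  R = record
    { ρ        = ρᴳ
    ; ρ-tail   = λ d → trans (ρ⁺-tail (classify d)) (cong tail (embed-classify d))
    ; ρ-inj    = λ a b e → trans (sym (embed-classify a))
                   (trans (cong embed (ρ⁺-injective _ _ (embed-injective _ _ e))) (embed-classify b))
    ; ρ-cyclic = cyclic
    }
    where
    cyclic : ∀ d d' → tail d ≡ tail d' → Orbit ρᴳ d d'
    cyclic d d' e =
      subst₂ (Orbit ρᴳ) (embed-classify d) (embed-classify d')
        (orbit-conj ρᴳ ρ⁺ embed ρᴳ-embed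
          (ρ⁺-cyclic _ _ (trans (cong tail (embed-classify d)) (trans e (sym (cong tail (embed-classify d')))))))

  adj-to-u : ∀ {s t} → Joins p q s t → adj s u ≡ true
  adj-to-u (inj₁ (refl , _)) = adj-flip G u-p
  adj-to-u (inj₂ (_ , refl)) = adj-flip G u-q

  adj-from-u : ∀ {s t} → Joins p q s t → adj u t ≡ true
  adj-from-u (inj₁ (_ , refl)) = u-q
  adj-from-u (inj₂ (refl , _)) = u-p

  connected⇒connected' : ∀ {a b} → Connected G a b → Connected G' a b
  connected⇒connected' ε = ε
  connected⇒connected' (_◅_ {j = t} e rest) with joins? _≟_ p q _ t
  ... | no ¬j = kept e ¬j ◅ connected⇒connected' rest
  ... | yes j = kept (adj-to-u j) ¬joins-to-u ◅ kept (adj-from-u j) ¬joins-from-u ◅ connected⇒connected' rest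

  components-preserved : ∀ c → HasComponents G' c → HasComponents G c
  components-preserved c (f , onto , same) =
    f , onto , λ a b → (gmap id adj'⇒adj ∘ proj₁ (same a b)) , (proj₂ (same a b) ∘ connected⇒connected')

  -- An endpoint of pq keeps its neighbour u in G'.
  isolated'⇒isolated : ∀ s → degree G' s ≡ 0 → degree G s ≡ 0
  isolated'⇒isolated s deg0 = false⇒count≡0 (adj s) no-neighbour
    where
    no-neighbour : ∀ t → adj s t ≡ false
    no-neighbour t with adj s t in e
    ... | false = refl
    ... | true with joins? _≟_ p q s t
    ...   | no ¬j = contradiction (trans (sym (kept e ¬j)) (count≡0⇒false (adj' s) deg0 t)) λ ()
    ...   | yes j = contradiction
                      (trans (sym (kept (adj-to-u j) ¬joins-to-u)) (count≡0⇒false (adj' s) deg0 u)) λ ()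

  isolated⇒isolated' : ∀ s → degree G s ≡ 0 → degree G' s ≡ 0
  isolated⇒isolated' s deg0 = false⇒count≡0 (adj' s) λ t →
    trans (adj'-≡ s t) (cong (_∧ _) (count≡0⇒false (adj s) deg0 t))

  isolatedCount-preserved : isolatedCount G ≡ isolatedCount G'
  isolatedCount-preserved = count-cong _ _ same
    where
    same : ∀ s → (degree G s ≡ᵇ 0) ≡ (degree G' s ≡ᵇ 0)
    same s with degree G s in e | degree G' s in e'
    ... | zero  | zero  = refl
    ... | suc _ | suc _ = refl
    ... | zero  | suc _ = contradiction (trans (sym (isolated⇒isolated' s e)) e') λ ()
    ... | suc _ | zero  = contradiction (trans (sym (isolated'⇒isolated s e')) e) λ ()

  adj-pq : ∀ {s t} → Joins p q s t → adj s t ≡ true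
  adj-pq (inj₁ (refl , refl)) = p-q
  adj-pq (inj₂ (refl , refl)) = adj-flip G p-q

  -- The edge pq is counted once, at its endpoint m with the smaller index.
  edgeCount-at : ∀ m M → Joins p q m M → toℕ m < toℕ M → edgeCount G ≡ suc (edgeCount G')
  edgeCount-at m M mM m<M = sumFin-differ-at _ _ m at-m elsewhere
    where
    forward : Fin n → Fin n → Bool
    forward s t = toℕ s <ᵇ toℕ t

    at-m : count (λ t → adj m t ∧ forward m t) ≡ suc (count (λ t → adj' m t ∧ forward m t))
    at-m = count-differ-at _ _ M
             (trans (cong (_∧ forward m M) (adj-pq mM)) (<ᵇ≡true m<M))
             (cong (_∧ forward m M) (adj'-pq mM))
             (λ t t≢M → cong (_∧ forward m t)
                (sym (adj'-¬joins (λ j → t≢M (Joins-functional p≢q (Joins-transfer pq-deleted j) mM)))))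

    elsewhere : ∀ s → s ≢ m → count (λ t → adj s t ∧ forward s t) ≡ count (λ t → adj' s t ∧ forward s t)
    elsewhere s s≢m = count-cong _ _ same
      where
      same : ∀ t → (adj s t ∧ forward s t) ≡ (adj' s t ∧ forward s t)
      same t with joins? _≟_ p q s t
      ... | no ¬j = cong (_∧ forward s t) (sym (adj'-¬joins (¬j ∘ Joins-transfer pq-deleted)))
      ... | yes j with Joins-opposite j mM s≢m
      ...   | refl , refl rewrite <ᵇ≡false m<M = trans (∧-zeroʳ (adj s t)) (sym (∧-zeroʳ (adj' s t)))

  edgeCount-insert : edgeCount G ≡ suc (edgeCount G')
  edgeCount-insert with <-cmp (toℕ p) (toℕ q)
  ... | tri< p<q _ _ = edgeCount-at p q (inj₁ (refl , refl)) p<q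
  ... | tri≈ _ p≡q _ = ⊥-elim (p≢q (toℕ-injective p≡q))
  ... | tri> _ _ q<p = edgeCount-at q p (inj₂ (refl , refl)) q<p

  rev⁺ : Dart⁺ → Dart⁺
  rev⁺ (old d) = old (rev' d)
  rev⁺ pq = qp
  rev⁺ qp = pq

  φ⁺ : Dart⁺ → Dart⁺
  φ⁺ x = ρ⁺ (rev⁺ x)

  φᴳ-embed : ∀ x → φ R (embed x) ≡ embed (φ⁺ x)
  φᴳ-embed x = trans (cong ρᴳ (embed-rev x)) (ρᴳ-embed (rev⁺ x))
    where
    embed-rev : ∀ x → rev G (embed x) ≡ embed (rev⁺ x)
    embed-rev (old d) = dart-≡ refl refl
    embed-rev pq      = dart-≡ refl refl
    embed-rev qp      = dart-≡ refl refl

  φ'-injective : ∀ a b → φ' a ≡ φ' b → a ≡ b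
  φ'-injective = φ-injective R'

  data φ⁺-OldView (d : D') : Dart⁺ → Set where
    to-pq  : φ' d ≡ pu → φ⁺-OldView d pq
    to-qp  : d ≡ uq → φ⁺-OldView d qp
    to-old : φ' d ≢ pu → d ≢ uq → φ⁺-OldView d (old (φ' d))

  φ⁺-view : ∀ d → φ⁺-OldView d (φ⁺ (old d))
  φ⁺-view d with ρ⁺ (old (rev' d)) | ρ⁺-view (rev' d)
  ... | _ | to-pq e        = to-pq e
  ... | _ | to-qp _ e      = to-qp (dart-≡ (cong head e) (cong tail e))
  ... | _ | to-old ≢pu ≢qu = to-old ≢pu (λ e → ≢qu (dart-≡ (cong head e) (cong tail e)))

  qu⁺ : D'
  qu⁺ = ρ' qu

  qu⁺-tail : tail qu⁺ ≡ q
  qu⁺-tail = ρ'-tail qu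

  pu⁻ᶠ : D'
  pu⁻ᶠ = rev' pu⁻

  φ'pu⁻ᶠ : φ' pu⁻ᶠ ≡ pu
  φ'pu⁻ᶠ = trans (cong ρ' (rev-involutive pu⁻)) ρ'pu⁻

  head-pu⁻ᶠ : head pu⁻ᶠ ≡ p
  head-pu⁻ᶠ = tail-pu⁻

  AtCorner : D' → Set
  AtCorner d = d ≡ pu ⊎ d ≡ uq

  at-corner? : ∀ d → Dec (AtCorner d)
  at-corner? d = (d ≟ᵈ pu) ⊎-dec (d ≟ᵈ uq)

  qu⁺-off : ¬ AtCorner qu⁺
  qu⁺-off (inj₁ e) = p≢q (trans (sym (cong tail e)) qu⁺-tail)
  qu⁺-off (inj₂ e) = u≢q (trans (sym (cong tail e)) qu⁺-tail)

  pu⁻ᶠ-off : ¬ AtCorner pu⁻ᶠ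
  pu⁻ᶠ-off (inj₁ e) = u≢p (trans (sym (cong head e)) head-pu⁻ᶠ)
  pu⁻ᶠ-off (inj₂ e) = p≢q (trans (sym head-pu⁻ᶠ) (cong head e))

  φ'uq : φ' uq ≡ qu⁺
  φ'uq = cong ρ' (dart-≡ refl refl)

  φ⁺-into-pq : ∀ d → φ' d ≡ pu → φ⁺ (old d) ≡ pq
  φ⁺-into-pq d e with φ⁺ (old d) | φ⁺-view d
  ... | _ | to-pq _      = refl
  ... | _ | to-qp refl   = ⊥-elim (qu⁺-off (inj₁ (trans (sym φ'uq) e)))
  ... | _ | to-old ≢pu _ = ⊥-elim (≢pu e)

  -- Inserting pq into the face corner p u q of G' splits its face into the triangle
  -- pu, uq, qp and the face in which pq replaces the path pu, uq.
  module _ (corner : ρ' up ≡ uq) where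

    φ'pu : φ' pu ≡ uq
    φ'pu = trans (cong ρ' (dart-≡ refl refl)) corner

    φ⁺-pu : φ⁺ (old pu) ≡ old uq
    φ⁺-pu with φ⁺ (old pu) | φ⁺-view pu
    ... | _ | to-pq e      = ⊥-elim (u≢p (trans (sym (tail-φ R' pu)) (cong tail e)))
    ... | _ | to-qp e      = ⊥-elim (u≢p (sym (cong tail e)))
    ... | _ | to-old _ _   = cong old φ'pu

    φ⁺-uq : φ⁺ (old uq) ≡ qp
    φ⁺-uq with φ⁺ (old uq) | φ⁺-view uq
    ... | _ | to-pq e      = ⊥-elim (p≢q (trans (sym (cong tail e)) (tail-φ R' uq)))
    ... | _ | to-qp _      = refl
    ... | _ | to-old _ ≢uq = ⊥-elim (≢uq refl)

    φ⁺-old : ∀ d → ¬ AtCorner d → φ' d ≢ pu → φ⁺ (old d) ≡ old (φ' d)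
    φ⁺-old d off ≢pu with φ⁺ (old d) | φ⁺-view d
    ... | _ | to-pq e    = ⊥-elim (≢pu e)
    ... | _ | to-qp e    = ⊥-elim (off (inj₂ e))
    ... | _ | to-old _ _ = refl

    into-pu⇒off-corner : ∀ d → φ' d ≡ pu → ¬ AtCorner d
    into-pu⇒off-corner d e (inj₁ refl) = u≢p (cong tail (trans (sym φ'pu) e))
    into-pu⇒off-corner d e (inj₂ refl) = qu⁺-off (inj₁ (trans (sym φ'uq) e))

    φ'-stays-off : ∀ d → ¬ AtCorner d → φ' d ≢ pu → ¬ AtCorner (φ' d)
    φ'-stays-off d off ≢pu (inj₁ e) = ≢pu e
    φ'-stays-off d off ≢pu (inj₂ e) = off (inj₁ (φ'-injective d pu (trans e (sym φ'pu))))

    mutual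
      -- A segment of an old face walk between darts off the corner is also traversed by
      -- the new walk, which takes the shortcut pq where the old walk enters pu.
      orbit-shortcut : ∀ k d₁ d₂ → ¬ AtCorner d₁ → ¬ AtCorner d₂ → iter φ' k d₁ ≡ d₂ →
                       Orbit φ⁺ (old d₁) (old d₂)
      orbit-shortcut zero    d₁ d₂ off₁ off₂ refl = 0 , refl
      orbit-shortcut (suc k) d₁ d₂ off₁ off₂ e with φ' d₁ ≟ᵈ pu
      ... | yes ≡pu = orbit-trans φ⁺ (2 , cong φ⁺ (φ⁺-into-pq d₁ ≡pu))
                        (shortcut-from-pu k d₂ off₂ (trans (cong (iter φ' k) (sym ≡pu))
                                                      (trans (sym (iter-sucʳ φ' k d₁)) e)))
      ... | no ≢pu  = orbit-trans φ⁺ (1 , φ⁺-old d₁ off₁ ≢pu)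
                        (orbit-shortcut k (φ' d₁) d₂ (φ'-stays-off d₁ off₁ ≢pu) off₂
                          (trans (sym (iter-sucʳ φ' k d₁)) e))

      shortcut-from-pu : ∀ k d₂ → ¬ AtCorner d₂ → iter φ' k pu ≡ d₂ → Orbit φ⁺ (old qu⁺) (old d₂)
      shortcut-from-pu zero          d₂ off₂ e = ⊥-elim (off₂ (inj₁ (sym e)))
      shortcut-from-pu (suc zero)    d₂ off₂ e = ⊥-elim (off₂ (inj₂ (trans (sym e) φ'pu)))
      shortcut-from-pu (suc (suc k)) d₂ off₂ e =
        orbit-shortcut k qu⁺ d₂ qu⁺-off off₂
          (trans (cong (iter φ' k) (sym (trans (cong φ' φ'pu) φ'uq)))
            (trans (sym (iter-sucʳ φ' k (φ' pu))) (trans (sym (iter-sucʳ φ' (suc k) pu)) e)))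

    module _ {F : ℕ} (f' : D' → Fin F) (f'-faces : ∀ d d' → (f' d ≡ f' d') ⇔ SameFace R' d d') where

      f'-φ' : ∀ d → f' (φ' d) ≡ f' d
      f'-φ' d = sym (proj₂ (f'-faces d (φ' d)) (1 , refl))

      f'-uq : f' uq ≡ f' pu
      f'-uq = trans (cong f' (sym φ'pu)) (f'-φ' pu)

      f'-corner : ∀ {d} → AtCorner d → f' d ≡ f' pu
      f'-corner (inj₁ refl) = refl
      f'-corner (inj₂ refl) = f'-uq

      f'-qu⁺ : f' qu⁺ ≡ f' pu
      f'-qu⁺ = trans (cong f' (sym φ'uq)) (trans (f'-φ' uq) f'-uq)

      f'-pu⁻ᶠ : f' pu⁻ᶠ ≡ f' pu
      f'-pu⁻ᶠ = trans (sym (f'-φ' pu⁻ᶠ)) (cong f' φ'pu⁻ᶠ)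

      -- The triangle pu, uq, qp is the new face F; every other new face keeps its old label.
      label : Dart⁺ → Fin (suc F)
      label (old d) with at-corner? d
      ... | yes _ = fromℕ F
      ... | no _  = inject₁ (f' d)
      label pq = inject₁ (f' pu)
      label qp = fromℕ F

      label-corner : ∀ {d} → AtCorner d → label (old d) ≡ fromℕ F
      label-corner {d} c with at-corner? d
      ... | yes _ = refl
      ... | no nc = ⊥-elim (nc c)

      label-off : ∀ {d} → ¬ AtCorner d → label (old d) ≡ inject₁ (f' d)
      label-off {d} nc with at-corner? d
      ... | yes c = ⊥-elim (nc c)
      ... | no _  = refl

      label-φ⁺ : ∀ x → label (φ⁺ x) ≡ label x
      label-φ⁺ (old d) with φ⁺ (old d) | φ⁺-view d
      ... | _ | to-pq e = trans (cong inject₁ (trans (cong f' (sym e)) (f'-φ' d)))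
                                (sym (label-off (into-pu⇒off-corner d e)))
      ... | _ | to-qp e = sym (label-corner (inj₂ e))
      ... | _ | to-old ≢pu ≢uq with at-corner? d
      ...   | yes (inj₁ refl) = label-corner (inj₂ φ'pu)
      ...   | yes (inj₂ e)    = ⊥-elim (≢uq e)
      ...   | no off          = trans (label-off (φ'-stays-off d off ≢pu)) (cong inject₁ (f'-φ' d))
      label-φ⁺ pq = trans (label-off qu⁺-off) (cong inject₁ f'-qu⁺)
      label-φ⁺ qp = label-corner (inj₁ refl)

      label-orbit : ∀ {x y} → Orbit φ⁺ x y → label x ≡ label y
      label-orbit {x} (k , refl) = sym (iterated k)
        where
        iterated : ∀ k → label (iter φ⁺ k x) ≡ label x
        iterated zero    = refl
        iterated (suc k) = trans (label-φ⁺ (iter φ⁺ k x)) (iterated k)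

      same-face⇒orbit : ∀ {d₁ d₂} → ¬ AtCorner d₁ → ¬ AtCorner d₂ → f' d₁ ≡ f' d₂ →
                        Orbit φ⁺ (old d₁) (old d₂)
      same-face⇒orbit {d₁} {d₂} off₁ off₂ e with proj₁ (f'-faces d₁ d₂) e
      ... | k , reach = orbit-shortcut k d₁ d₂ off₁ off₂ reach

      data Triangle : Dart⁺ → Set where
        tri-pu : Triangle (old pu)
        tri-uq : Triangle (old uq)
        tri-qp : Triangle qp

      data Rest : Dart⁺ → Set where
        rest-old : ∀ {d} → ¬ AtCorner d → Rest (old d)
        rest-pq  : Rest pq

      triangle-or-rest : ∀ x → Triangle x ⊎ Rest x
      triangle-or-rest (old d) with at-corner? d
      ... | yes (inj₁ refl) = inj₁ tri-pu
      ... | yes (inj₂ refl) = inj₁ tri-uq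
      ... | no off          = inj₂ (rest-old off)
      triangle-or-rest pq = inj₂ rest-pq
      triangle-or-rest qp = inj₁ tri-qp

      label-triangle : ∀ {x} → Triangle x → label x ≡ fromℕ F
      label-triangle tri-pu = label-corner (inj₁ refl)
      label-triangle tri-uq = label-corner (inj₂ refl)
      label-triangle tri-qp = refl

      label-rest : ∀ {x} → Rest x → ∃ λ j → label x ≡ inject₁ j
      label-rest (rest-old off) = _ , label-off off
      label-rest rest-pq        = _ , refl

      triangle-orbit : ∀ {x y} → Triangle x → Triangle y → Orbit φ⁺ x y
      triangle-orbit tri-pu tri-pu = 0 , refl
      triangle-orbit tri-pu tri-uq = 1 , φ⁺-pu
      triangle-orbit tri-pu tri-qp = 2 , trans (cong φ⁺ φ⁺-pu) φ⁺-uq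
      triangle-orbit tri-uq tri-pu = 2 , cong φ⁺ φ⁺-uq
      triangle-orbit tri-uq tri-uq = 0 , refl
      triangle-orbit tri-uq tri-qp = 1 , φ⁺-uq
      triangle-orbit tri-qp tri-pu = 1 , refl
      triangle-orbit tri-qp tri-uq = 2 , φ⁺-pu
      triangle-orbit tri-qp tri-qp = 0 , refl

      rest-orbit : ∀ {x y} → Rest x → Rest y → label x ≡ label y → Orbit φ⁺ x y
      rest-orbit (rest-old off₁) (rest-old off₂) e =
        same-face⇒orbit off₁ off₂ (inject₁-injective (trans (sym (label-off off₁)) (trans e (label-off off₂))))
      rest-orbit rest-pq (rest-old off₂) e =
        orbit-trans φ⁺ (1 , refl)
          (same-face⇒orbit qu⁺-off off₂ (trans f'-qu⁺ (inject₁-injective (trans e (label-off off₂)))))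
      rest-orbit (rest-old off₁) rest-pq e =
        orbit-trans φ⁺
          (same-face⇒orbit off₁ pu⁻ᶠ-off
            (trans (inject₁-injective (trans (sym (label-off off₁)) e)) (sym f'-pu⁻ᶠ)))
          (1 , φ⁺-into-pq pu⁻ᶠ φ'pu⁻ᶠ)
      rest-orbit rest-pq rest-pq e = 0 , refl

      label⇒orbit : ∀ x y → label x ≡ label y → Orbit φ⁺ x y
      label⇒orbit x y e with triangle-or-rest x | triangle-or-rest y
      ... | inj₁ tx | inj₁ ty = triangle-orbit tx ty
      ... | inj₂ rx | inj₂ ry = rest-orbit rx ry e
      ... | inj₁ tx | inj₂ ry = ⊥-elim (fromℕ≢inject₁ (trans (sym (label-triangle tx)) (trans e (proj₂ (label-rest ry)))))
      ... | inj₂ rx | inj₁ ty = ⊥-elim (fromℕ≢inject₁ (trans (sym (label-triangle ty)) (trans (sym e) (proj₂ (label-rest rx)))))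

      orbitᴳ⇔orbit⁺ : ∀ d d' → SameFace R d d' ⇔ Orbit φ⁺ (classify d) (classify d')
      orbitᴳ⇔orbit⁺ d d' = to , from
        where
        to : SameFace R d d' → Orbit φ⁺ (classify d) (classify d')
        to (k , reach) = k , embed-injective _ _ (begin
          embed (iter φ⁺ k (classify d))     ≡⟨ sym (iter-natural (φ R) φ⁺ embed φᴳ-embed k (classify d)) ⟩
          iter (φ R) k (embed (classify d))  ≡⟨ cong (iter (φ R) k) (embed-classify d) ⟩
          iter (φ R) k d                     ≡⟨ reach ⟩
          d'                                 ≡⟨ sym (embed-classify d') ⟩
          embed (classify d')                ∎)
          where open ≡-Reasoning
        from : Orbit φ⁺ (classify d) (classify d') → SameFace R d d'
        from o = subst₂ (SameFace R) (embed-classify d) (embed-classify d') (orbit-conj (φ R) φ⁺ embed φᴳ-embed o)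

      faces-insert : (∀ i → ∃ λ d → f' d ≡ i) → HasFaces R (suc F)
      faces-insert onto = label ∘ classify , onto⁺ , faces⁺
        where
        onto⁺ : ∀ i → ∃ λ d → label (classify d) ≡ i
        onto⁺ i with Top.view i
        ... | ‵fromℕ     = embed qp , cong label (classify-embed qp)
        ... | ‵inject₁ j with onto j
        ...   | d , refl with at-corner? d
        ...     | yes c  = embed pq , trans (cong label (classify-embed pq)) (cong inject₁ (sym (f'-corner c)))
        ...     | no off = embed (old d) , trans (cong label (classify-embed (old d))) (label-off off)
        faces⁺ : ∀ d d' → (label (classify d) ≡ label (classify d')) ⇔ SameFace R d d'
        faces⁺ d d' = proj₂ (orbitᴳ⇔orbit⁺ d d') ∘ label⇒orbit _ _ , label-orbit ∘ proj₁ (orbitᴳ⇔orbit⁺ d d')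

    genus-insert : ∀ g → HasGenus R' g → HasGenus R g
    genus-insert g (c , F , comps , (f' , onto , faces) , euler) =
      c , suc F , components-preserved c comps , faces-insert f' faces onto , euler⁺
      where
      euler⁺ : n + suc F + isolatedCount G + 2 * g ≡ 2 * c + edgeCount G
      euler⁺ rewrite +-suc n F | isolatedCount-preserved | edgeCount-insert | +-suc (2 * c) (edgeCount G') =
        cong suc euler

    -- The dart of G that takes the place of d in the face walks: pq replaces pu.
    lift : D' → Dart⁺
    lift d with d ≟ᵈ pu
    ... | yes _ = pq
    ... | no _  = old d

    lift-pu : lift pu ≡ pq
    lift-pu with pu ≟ᵈ pu
    ... | yes _   = refl
    ... | no ≢pu  = ⊥-elim (≢pu refl)

    lift-old : ∀ {d} → d ≢ pu → lift d ≡ old d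
    lift-old {d} ≢pu with d ≟ᵈ pu
    ... | yes e = ⊥-elim (≢pu e)
    ... | no _  = refl

    lift-tail : ∀ d → tail⁺ (lift d) ≡ tail d
    lift-tail d with d ≟ᵈ pu
    ... | yes refl = refl
    ... | no _     = refl

    lift-injective : ∀ a b → lift a ≡ lift b → a ≡ b
    lift-injective a b e with a ≟ᵈ pu | b ≟ᵈ pu
    ... | yes refl | yes refl = refl
    ... | no _     | no _     = old-injective e
    lift-injective a b () | yes _ | no _
    lift-injective a b () | no _  | yes _

    φ⁺-lift : ∀ d → ¬ AtCorner d → φ⁺ (lift d) ≡ lift (φ' d)
    φ⁺-lift d off with φ' d ≟ᵈ pu
    ... | yes e  = trans (cong φ⁺ (lift-old (off ∘ inj₁))) (φ⁺-into-pq d e)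
    ... | no ≢pu = trans (cong φ⁺ (lift-old (off ∘ inj₁))) (φ⁺-old d off ≢pu)

    alternating-from⁺ : ∀ {x y} (a : Dart⁺) (j₁ j₂ j₃ j₄ : ℕ) → j₁ < j₂ → j₂ < j₃ → j₃ < j₄ →
      (∀ k → 0 < k → k ≤ j₄ → iter φ⁺ k a ≢ a) →
      tail⁺ (iter φ⁺ j₁ a) ≡ x → tail⁺ (iter φ⁺ j₂ a) ≡ y → tail⁺ (iter φ⁺ j₃ a) ≡ x → tail⁺ (iter φ⁺ j₄ a) ≡ y →
      AlternatingFace G R x y
    alternating-from⁺ a j₁ j₂ j₃ j₄ j₁<j₂ j₂<j₃ j₃<j₄ no-return t₁ t₂ t₃ t₄ =
      embed a , j₁ , j₂ , j₃ , j₄ , j₁<j₂ , j₂<j₃ , j₃<j₄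
      , (λ k 0<k k≤j₄ e → no-return k 0<k k≤j₄ (embed-injective _ _ (trans (sym (walk k)) e)))
      , tail-walk j₁ t₁ , tail-walk j₂ t₂ , tail-walk j₃ t₃ , tail-walk j₄ t₄
      where
      walk : ∀ k → iter (φ R) k (embed a) ≡ embed (iter φ⁺ k a)
      walk k = iter-natural (φ R) φ⁺ embed φᴳ-embed k a
      tail-walk : ∀ {z} k → tail⁺ (iter φ⁺ k a) ≡ z → tail (iter (φ R) k (embed a)) ≡ z
      tail-walk k e = trans (cong tail (walk k)) e

    -- The old walk from s reaches pu at step r, if r ≤ N. The new walk from lift s follows
    -- it up to step r and afterwards runs one step ahead, having skipped uq.
    module Walk (s : D') (N : ℕ) (no-return : ∀ j → 0 < j → j ≤ N → iter φ' j s ≢ s) (s-off : tail s ≢ u)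
                (r : ℕ) (hit : r ≤ N → iter φ' r s ≡ pu) (miss : ∀ k → k < r → iter φ' k s ≢ pu) where

      old-at : ℕ → D'
      old-at j = iter φ' j s

      new-at : ℕ → Dart⁺
      new-at j = iter φ⁺ j (lift s)

      off-before : ∀ j → j < r → ¬ AtCorner (old-at j)
      off-before j       j<r (inj₁ e) = miss j j<r e
      off-before zero    j<r (inj₂ e) = s-off (cong tail e)
      off-before (suc j) j<r (inj₂ e) = miss j (<-trans (n<1+n j) j<r) (φ'-injective _ _ (trans e (sym φ'pu)))

      walk-before : ∀ j → j ≤ r → new-at j ≡ lift (old-at j)
      walk-before zero    _   = refl
      walk-before (suc j) j<r = trans (cong φ⁺ (walk-before j (<⇒≤ j<r))) (φ⁺-lift (old-at j) (off-before j j<r))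

      miss-after : ∀ j → r < j → j ≤ N → old-at j ≢ pu
      miss-after j r<j j≤N e =
        iter-distinct φ' φ'-injective no-return r j r<j j≤N (trans (hit (<⇒≤ (<-≤-trans r<j j≤N))) (sym e))

      walk-after : ∀ j → r < j → suc j ≤ N → new-at j ≡ old (old-at (suc j))
      walk-after (suc j) r<1+j 2+j≤N with m≤n⇒m<n∨m≡n (≤-pred r<1+j)
      ... | inj₂ refl = begin
        φ⁺ (new-at r)               ≡⟨ cong φ⁺ (walk-before r ≤-refl) ⟩
        φ⁺ (lift (old-at r))        ≡⟨ cong (φ⁺ ∘ lift) r-hit ⟩
        φ⁺ (lift pu)                ≡⟨ cong φ⁺ lift-pu ⟩
        old qu⁺                     ≡⟨ cong old (sym (trans (cong (φ' ∘ φ') r-hit) (trans (cong φ' φ'pu) φ'uq))) ⟩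
        old (old-at (suc (suc r)))  ∎
        where
        open ≡-Reasoning
        r-hit : old-at r ≡ pu
        r-hit = hit (<⇒≤ (<⇒≤ 2+j≤N))
      ... | inj₁ r<j = trans (cong φ⁺ (walk-after j r<j (<⇒≤ 2+j≤N)))
                         (φ⁺-old (old-at (suc j)) off (miss-after (suc (suc j)) r<2+j 2+j≤N))
        where
        r<2+j : r < suc (suc j)
        r<2+j = <-trans r<1+j (n<1+n (suc j))
        off : ¬ AtCorner (old-at (suc j))
        off (inj₁ e) = miss-after (suc j) r<1+j (<⇒≤ 2+j≤N) e
        off (inj₂ e) = miss-after j r<j (<⇒≤ (<⇒≤ 2+j≤N)) (φ'-injective _ _ (trans e (sym φ'pu)))

      -- Position j of the new walk shows the vertex at position i of the old walk.
      Reindex : ℕ → ℕ → Set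
      Reindex i j = (i ≤ r × j ≡ i) ⊎ (r < j × suc j ≡ i)

      reindex : ∀ i → i ≤ N → tail (old-at i) ≢ u →
                ∃ λ j → tail⁺ (new-at j) ≡ tail (old-at i) × Reindex i j
      reindex i i≤N i-off with <-cmp i r
      ... | tri< i<r _ _ = i , trans (cong tail⁺ (walk-before i (<⇒≤ i<r))) (lift-tail _) , inj₁ (<⇒≤ i<r , refl)
      ... | tri≈ _ refl _ = i , trans (cong tail⁺ (walk-before i ≤-refl)) (lift-tail _) , inj₁ (≤-refl , refl)
      reindex (suc j) i≤N i-off | tri> _ _ r<1+j with m≤n⇒m<n∨m≡n (≤-pred r<1+j)
      ... | inj₁ r<j  = j , cong tail⁺ (walk-after j r<j i≤N) , inj₂ (r<j , refl)
      ... | inj₂ refl = ⊥-elim (i-off (cong tail (trans (cong φ' (hit (<⇒≤ i≤N))) φ'pu)))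

      reindex-mono : ∀ {i j i' j'} → Reindex i j → Reindex i' j' → i < i' → j < j'
      reindex-mono (inj₁ (_ , refl))    (inj₁ (_ , refl))     i<i' = i<i'
      reindex-mono (inj₁ (i≤r , refl))  (inj₂ (r<j' , _))     i<i' = ≤-<-trans i≤r r<j'
      reindex-mono (inj₂ (r<j , refl))  (inj₁ (i'≤r , refl))  i<i' =
        ⊥-elim (<-irrefl refl (≤-trans (<-trans r<j (n<1+n _)) (≤-trans (<⇒≤ i<i') i'≤r)))
      reindex-mono (inj₂ (_ , refl))    (inj₂ (_ , refl))     i<i' = ≤-pred i<i'

      reindex-≤ : ∀ {i j} → Reindex i j → j ≤ i
      reindex-≤ (inj₁ (_ , refl)) = ≤-refl
      reindex-≤ (inj₂ (_ , refl)) = n≤1+n _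

      lifted-position : ∀ {j₄} → Reindex N j₄ → ∀ k → 0 < k → k ≤ j₄ →
                        ∃ λ m → 0 < m × m ≤ N × new-at k ≡ lift (old-at m)
      lifted-position {j₄} re k 0<k k≤j₄ with <-cmp k r
      ... | tri< k<r _ _  = k , 0<k , ≤-trans k≤j₄ (reindex-≤ re) , walk-before k (<⇒≤ k<r)
      ... | tri≈ _ refl _ = k , 0<k , ≤-trans k≤j₄ (reindex-≤ re) , walk-before k ≤-refl
      ... | tri> _ _ r<k  = suc k , s≤s z≤n , 1+k≤N re ,
                              trans (walk-after k r<k (1+k≤N re))
                                (sym (lift-old (miss-after (suc k) (<-trans r<k (n<1+n k)) (1+k≤N re))))
        where
        1+k≤N : Reindex N j₄ → suc k ≤ N
        1+k≤N (inj₁ (N≤r , refl)) = ⊥-elim (<-irrefl refl (≤-trans (s≤s k≤j₄) (≤-trans (s≤s N≤r) r<k)))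
        1+k≤N (inj₂ (_ , refl))   = s≤s k≤j₄

      no-return⁺ : ∀ {j₄} → Reindex N j₄ → ∀ k → 0 < k → k ≤ j₄ → new-at k ≢ lift s
      no-return⁺ re k 0<k k≤j₄ e with lifted-position re k 0<k k≤j₄
      ... | m , 0<m , m≤N , at-m = no-return m 0<m m≤N (lift-injective _ _ (trans (sym at-m) e))

      alternating : ∀ {x y} → x ≢ u → y ≢ u → ∀ i₂ i₃ → 0 < i₂ → i₂ < i₃ → i₃ < N →
        tail s ≡ x → tail (old-at i₂) ≡ y → tail (old-at i₃) ≡ x → tail (old-at N) ≡ y →
        AlternatingFace G R x y
      alternating x≢u y≢u i₂ i₃ 0<i₂ i₂<i₃ i₃<N t₁ t₂ t₃ t₄
        with at 0 z≤n t₁ x≢u | at i₂ (<⇒≤ (<-trans i₂<i₃ i₃<N)) t₂ y≢u | at i₃ (<⇒≤ i₃<N) t₃ x≢u | at N ≤-refl t₄ y≢u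
        where
        at : ∀ {z} i → i ≤ N → tail (old-at i) ≡ z → z ≢ u → ∃ λ j → tail⁺ (new-at j) ≡ z × Reindex i j
        at i i≤N t z≢u with reindex i i≤N (λ e → z≢u (trans (sym t) e))
        ... | j , tj , re = j , trans tj t , re
      ... | j₁ , e₁ , re₁ | j₂ , e₂ , re₂ | j₃ , e₃ , re₃ | j₄ , e₄ , re₄ =
        alternating-from⁺ (lift s) j₁ j₂ j₃ j₄
          (reindex-mono re₁ re₂ 0<i₂) (reindex-mono re₂ re₃ i₂<i₃) (reindex-mono re₃ re₄ i₃<N)
          (no-return⁺ re₄) e₁ e₂ e₃ e₄

    alternating-insert : ∀ {x y} → x ≢ u → y ≢ u → AlternatingFace G' R' x y → AlternatingFace G R x y
    alternating-insert x≢u y≢u (d , i₁ , i₂ , i₃ , i₄ , i₁<i₂ , i₂<i₃ , i₃<i₄ , no-return , t₁ , t₂ , t₃ , t₄)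
      with m≤n⇒∃[o]m+o≡n (<⇒≤ i₁<i₂) | m≤n⇒∃[o]m+o≡n (<⇒≤ (<-trans i₁<i₂ i₂<i₃))
         | m≤n⇒∃[o]m+o≡n (<⇒≤ (<-trans i₁<i₂ (<-trans i₂<i₃ i₃<i₄)))
    ... | a₂ , refl | a₃ , refl | a₄ , refl
      with first-hit (λ k → iter φ' k (iter φ' i₁ d) ≡ pu) (λ k → iter φ' k (iter φ' i₁ d) ≟ᵈ pu) a₄
    ... | r , _ , hit , miss =
      Walk.alternating s a₄ no-return-s (λ e → x≢u (trans (sym t₁) e)) r hit miss x≢u y≢u a₂ a₃
        (+-cancelˡ-< i₁ 0 a₂ (subst (_< i₁ + a₂) (sym (+-identityʳ i₁)) i₁<i₂))
        (+-cancelˡ-< i₁ a₂ a₃ i₂<i₃) (+-cancelˡ-< i₁ a₃ a₄ i₃<i₄)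
        t₁ (trans (cong tail (shifted a₂)) t₂) (trans (cong tail (shifted a₃)) t₃) (trans (cong tail (shifted a₄)) t₄)
      where
      s : D'
      s = iter φ' i₁ d
      shifted : ∀ a → iter φ' a s ≡ iter φ' (i₁ + a) d
      shifted a = trans (sym (iter-+ φ' a i₁ d)) (cong (λ m → iter φ' m d) (+-comm a i₁))
      no-return-s : ∀ j → 0 < j → j ≤ a₄ → iter φ' j s ≢ s
      no-return-s j 0<j j≤a₄ e = no-return j 0<j (≤-trans j≤a₄ (m≤n+m a₄ i₁))
        (iter-injective φ' φ'-injective i₁ _ _ (trans (sym (iter-+ φ' i₁ j d)) (trans (sym (shifted j)) e)))

-- Triangles at vertices of degree at most 3

module _ (G : Graph) {u v w : Fin (Graph.n G)}
         (u-v : Graph.adj G u v ≡ true) (v-w : Graph.adj G v w ≡ true) (u-w : Graph.adj G u w ≡ true)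
         (deg : degree G u ≤ 3) where
  open EdgeDeletion G v w

  ¬joins-from-u : ∀ {t} → ¬ Joins v w u t
  ¬joins-from-u (inj₁ (e , _)) = adj⇒≢ G u-v e
  ¬joins-from-u (inj₂ (_ , e)) = adj⇒≢ G u-w e

  uv uw : Dart G'
  uv = dart u v (adj⇒adj' u-v ¬joins-from-u)
  uw = dart u w (adj⇒adj' u-w ¬joins-from-u)

  reinsert-triangle-edge : ∀ g (R' : Rotation G') → HasGenus R' g →
    Σ (Rotation G) λ R → HasGenus R g × (∀ {x y} → x ≢ u → y ≢ u → AlternatingFace G' R' x y → AlternatingFace G R x y)
  reinsert-triangle-edge g R' genus
    with consecutive-at-degree≤3 R' (≤-trans (degree-G'≤ u) deg) uv uw refl refl (adj⇒≢ G v-w ∘ cong head)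
  ... | inj₁ uv↦uw = R , genus-insert corner g genus , alternating-insert corner
    where
    open CornerInsertion G v w u v w (inj₁ (refl , refl)) u-v u-w v-w R'
    corner : ρ' up ≡ uq
    corner = trans (cong ρ' (dart-≡ refl refl)) (trans uv↦uw (dart-≡ refl refl))
  ... | inj₂ uw↦uv = R , genus-insert corner g genus , alternating-insert corner
    where
    open CornerInsertion G v w u w v (inj₂ (refl , refl)) u-w u-v (adj-flip G v-w) R'
    corner : ρ' up ≡ uq
    corner = trans (cong ρ' (dart-≡ refl refl)) (trans uw↦uv (dart-≡ refl refl))

corollary27 : (T : TGraph) → InF T →
    ∀ u v w →
    Graph.adj (TGraph.graph T) u v ≡ true →
    Graph.adj (TGraph.graph T) v w ≡ true →
    Graph.adj (TGraph.graph T) u w ≡ true →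
    degree (TGraph.graph T) u ≤ 3 →
    u ≡ TGraph.x T ⊎ u ≡ TGraph.y T
corollary27 T inF u v w u-v v-w u-w deg with u ≟ TGraph.x T | u ≟ TGraph.y T
... | yes u≡x | _       = inj₁ u≡x
... | no _    | yes u≡y = inj₂ u≡y
... | no u≢x  | no u≢y  = ⊥-elim (InF.notA inF in-A)
  where
  G : Graph
  G = TGraph.graph T
  in-A : InA T
  in-A with InF.del inF v w v-w
  ... | inj₁ (R' , planar) with reinsert-triangle-edge G u-v v-w u-w deg 0 R' planar
  ...   | R , planar⁺ , _ = inj₁ (R , planar⁺)
  in-A | inj₂ (_ , R' , torus , alt) with reinsert-triangle-edge G u-v v-w u-w deg 1 R' torus
  ...   | R , torus⁺ , keep-alt =
    inj₂ ((InF.notA inF ∘ inj₁ , R , torus⁺) , R , torus⁺ , keep-alt (≢-sym u≢x) (≢-sym u≢y) alt)
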